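{- Let $(\Sigma,\mathscr{C},(-)^\sigma,(-)^+)$ be a canonicity framework, and let $\mathcal{S}\subseteq\Sigma$ be a class closed under ultraproducts. Then the variety of algebras generated by $\mathcal{S}^+=\{P^+:P\in\mathcal{S}\}$ (i.e. $\mathbf{HSP}\,\mathcal{S}^+$) is closed under the operation $(-)^\sigma$.
   Context: Write $\mathbb{A}\rightarrowtail\mathbb{B}$ if there is an injective homomorphism from $\mathbb{A}$ to $\mathbb{B}$, and $\mathbb{A}\twoheadrightarrow\mathbb{B}$ if there is a surjective one. A canonicity framework consists of: a class $\Sigma$ of structures (of some type, for which ultraproducts $\prod_U P_i$ are defined) that is closed under ultraproducts; a variety $\mathscr{C}$ of algebras of a given signature; an operation $(-)^\sigma\colon\mathscr{C}\to\mathscr{C}$; and an operation $(-)^+\colon\Sigma\to\mathscr{C}$; such that for all $\mathbb{A},\mathbb{B}\in\mathscr{C}$, all indexed families $\{P_i:i\in I\}\subseteq\Sigma$ and all $P\in\Sigma$: (A1) if $\mathbb{A}\rightarrowtail\mathbb{B}$ then $\mathbb{A}^\sigma\rightarrowtail\mathbb{B}^\sigma$, and if $\mathbb{A}\twoheadrightarrow\mathbb{B}$ then $\mathbb{A}^\sigma\twoheadrightarrow\mathbb{B}^\sigma$; (A2) $\prod_U(P_i^+)\rightarrowtail(\prod_U P_i)^+$ for every ultrafilter $U$ on $I$; (A3) there exists an ultrafilter $U$ with $(P^+)^\sigma\rightarrowtail(P^U)^+$, where $P^U$ is the ultrapower; (A4) $(\prod_I P_i^+)^\sigma\rightarrowtail\prod_{U\in\beta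 I}(\prod_U P_i^+)^\sigma$, where $\beta I$ is the set of ultrafilters on $I$. -}

module Defs where

open import Level using (Level; _⊔_) renaming (suc to lsuc)
open import Data.Nat using (ℕ; zero; suc)
open import Data.Fin using (Fin; zero; suc)
open import Data.Bool using (Bool; true; false; T; _∧_; not)
open import Data.Bool.Properties using (T-∧)
open import Data.Product using (Σ; _×_; _,_; proj₁; proj₂; ∃₂)
open import Data.Sum using (_⊎_)
open import Function.Bundles using (Equivalence)
open import Relation.Nullary using (¬_)
open import Relation.Binary using (Rel; IsEquivalence)
open import Relation.Unary using (Pred)
open import Relation.Binary.PropositionalEquality using (_≡_)

record Signature : Set₁ where
  field
    Op    : Set
    arity : Op → ℕ

record Algebra (Sg : Signature) (ℓ : Level) : Set (lsuc ℓ) where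
  open Signature Sg
  field
    Carrier : Set ℓ
    _≈_     : Rel Carrier ℓ
    isEquiv : IsEquivalence _≈_
    ⟦_⟧     : (f : Op) → (Fin (arity f) → Carrier) → Carrier
    ⟦⟧-cong : ∀ f {xs ys} → (∀ k → xs k ≈ ys k) → ⟦ f ⟧ xs ≈ ⟦ f ⟧ ys
  open IsEquivalence isEquiv public

module _ {Sg : Signature} {ℓ : Level} where
  open Signature Sg
  open Algebra

  record Hom (A B : Algebra Sg ℓ) : Set ℓ where
    field
      map   : Carrier A → Carrier B
      cong  : ∀ {x y} → _≈_ A x y → _≈_ B (map x) (map y)
      hom   : ∀ f (xs : Fin (arity f) → Carrier A) →
              _≈_ B (map (⟦_⟧ A f xs)) (⟦_⟧ B f (λ k → map (xs k)))

  Injective : {A B : Algebra Sg ℓ} → Hom A B → Set ℓ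
  Injective {A} {B} h = ∀ {x y} → _≈_ B (Hom.map h x) (Hom.map h y) → _≈_ A x y

  Surjective : {A B : Algebra Sg ℓ} → Hom A B → Set ℓ
  Surjective {A} {B} h = ∀ b → Σ (Carrier A) λ a → _≈_ B (Hom.map h a) b

  _↣_ : Algebra Sg ℓ → Algebra Sg ℓ → Set ℓ
  A ↣ B = Σ (Hom A B) Injective

  _↠_ : Algebra Sg ℓ → Algebra Sg ℓ → Set ℓ
  A ↠ B = Σ (Hom A B) Surjective

  ∏ : (I : Set ℓ) → (I → Algebra Sg ℓ) → Algebra Sg ℓ
  ∏ I A = record
    { Carrier = (i : I) → Carrier (A i)
    ; _≈_     = λ x y → ∀ i → _≈_ (A i) (x i) (y i)
    ; isEquiv = record
        { refl  = λ i → refl (A i)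
        ; sym   = λ p i → sym (A i) (p i)
        ; trans = λ p q i → trans (A i) (p i) (q i) }
    ; ⟦_⟧     = λ f xs i → ⟦_⟧ (A i) f (λ k → xs k i)
    ; ⟦⟧-cong = λ f eq i → ⟦⟧-cong (A i) f (λ k → eq k i)
    }

record Ultrafilter {ℓ : Level} (I : Set ℓ) : Set ℓ where
  field
    mem      : (I → Bool) → Bool
    mem-top  : T (mem (λ _ → true))
    proper   : ¬ T (mem (λ _ → false))
    mem-up   : ∀ {S R : I → Bool} → (∀ i → T (S i) → T (R i)) → T (mem S) → T (mem R)
    mem-∩    : ∀ {S R : I → Bool} → T (mem S) → T (mem R) → T (mem (λ i → S i ∧ R i))
    ultra    : ∀ (S : I → Bool) → T (mem S) ⊎ T (mem (λ i → not (S i)))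

module _ {ℓ : Level} {I : Set ℓ} (U : Ultrafilter I) where
  open Ultrafilter U

  private
    allS : ∀ n → (Fin n → I → Bool) → I → Bool
    allS zero    S i = true
    allS (suc n) S i = S zero i ∧ allS n (λ k → S (suc k)) i

    mem-all : ∀ n (S : Fin n → I → Bool) → (∀ k → T (mem (S k))) → T (mem (allS n S))
    mem-all zero    S h = mem-top
    mem-all (suc n) S h = mem-∩ (h zero) (mem-all n (λ k → S (suc k)) (λ k → h (suc k)))

    all-elim : ∀ n (S : Fin n → I → Bool) i → T (allS n S i) → ∀ k → T (S k i)
    all-elim (suc n) S i t zero    = proj₁ (Equivalence.to T-∧ t)
    all-elim (suc n) S i t (suc k) = all-elim n (λ k → S (suc k)) i (proj₂ (Equivalence.to T-∧ t)) k

  ∏[_] : {Sg : Signature} → (I → Algebra Sg ℓ) → Algebra Sg ℓ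
  ∏[_] {Sg} A = record
    { Carrier = (i : I) → Carrier (A i)
    ; _≈_     = _~_
    ; isEquiv = record
        { refl  = (λ _ → true) , mem-top , (λ i _ → refl (A i))
        ; sym   = λ { (S , m , f) → S , m , λ i t → sym (A i) (f i t) }
        ; trans = λ { (S , m , f) (R , n , g) →
                    (λ i → S i ∧ R i) , mem-∩ m n ,
                    λ i t → trans (A i) (f i (proj₁ (Equivalence.to T-∧ t)))
                                        (g i (proj₂ (Equivalence.to T-∧ t))) } }
    ; ⟦_⟧     = λ f xs i → ⟦_⟧ (A i) f (λ k → xs k i)
    ; ⟦⟧-cong = λ f {xs} {ys} eq →
        allS (Signature.arity Sg f) (λ k → proj₁ (eq k)) ,
        mem-all _ (λ k → proj₁ (eq k)) (λ k → proj₁ (proj₂ (eq k))) ,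
        λ i t → ⟦⟧-cong (A i) f (λ k → proj₂ (proj₂ (eq k)) i
                   (all-elim _ (λ k → proj₁ (eq k)) i t k))
    }
    where
    open Algebra
    _~_ : Rel ((i : I) → Carrier (A i)) ℓ
    x ~ y = Σ (I → Bool) λ S → T (mem S) × (∀ i → T (S i) → _≈_ (A i) (x i) (y i))

record IsVariety {Sg : Signature} {ℓ k : Level} (C : Pred (Algebra Sg ℓ) k) : Set (lsuc ℓ ⊔ k) where
  field
    H-closed : ∀ {A B} → C A → A ↠ B → C B
    S-closed : ∀ {A B} → C B → A ↣ B → C A
    P-closed : ∀ {I : Set ℓ} (A : I → Algebra Sg ℓ) → (∀ i → C (A i)) → C (∏ I A)

HSP : {Sg : Signature} {ℓ k : Level} → Pred (Algebra Sg ℓ) k → Pred (Algebra Sg ℓ) (lsuc ℓ ⊔ k)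
HSP {Sg} {ℓ} K B =
  Σ (Set ℓ) λ I → Σ (I → Algebra Sg ℓ) λ A → (∀ i → K (A i)) ×
  Σ (Algebra Sg ℓ) λ D → (D ↣ ∏ I A) × (D ↠ B)

record CanonicityFramework (Sg : Signature) (ℓ s k : Level) : Set (lsuc (ℓ ⊔ s ⊔ k)) where
  field
    -- the class Σ of structures, with its (abstract) ultraproduct operation;
    -- closure of Σ under ultraproducts is built into the type
    Str       : Set s
    ultraprod : {I : Set ℓ} → Ultrafilter I → (I → Str) → Str
    𝒞         : Pred (Algebra Sg ℓ) k
    𝒞-variety : IsVariety 𝒞
    _^σ       : Algebra Sg ℓ → Algebra Sg ℓ
    σ-in-𝒞    : ∀ {A} → 𝒞 A → 𝒞 (A ^σ)
    _⁺        : Str → Algebra Sg ℓ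
    ⁺-in-𝒞    : ∀ P → 𝒞 (P ⁺)
    A1-inj    : ∀ {A B} → 𝒞 A → 𝒞 B → A ↣ B → (A ^σ) ↣ (B ^σ)
    A1-surj   : ∀ {A B} → 𝒞 A → 𝒞 B → A ↠ B → (A ^σ) ↠ (B ^σ)
    A2        : ∀ {I : Set ℓ} (U : Ultrafilter I) (P : I → Str) →
                ∏[ U ] (λ i → P i ⁺) ↣ (ultraprod U P ⁺)
    A3        : ∀ (P : Str) → Σ (Set ℓ) λ I → Σ (Ultrafilter I) λ U →
                ((P ⁺) ^σ) ↣ (ultraprod U (λ _ → P) ⁺)
    A4        : ∀ {I : Set ℓ} (P : I → Str) →
                (∏ I (λ i → P i ⁺) ^σ) ↣ ∏ (Ultrafilter I) (λ U → ∏[ U ] (λ i → P i ⁺) ^σ)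

  _⁺-class : ∀ {p} → Pred Str p → Pred (Algebra Sg ℓ) (lsuc ℓ ⊔ s ⊔ p)
  (S ⁺-class) A = Σ Str λ P → S P × (P ⁺ ≡ A)

  UltraClosed : ∀ {p} → Pred Str p → Set (lsuc ℓ ⊔ s ⊔ p)
  UltraClosed S = ∀ {I : Set ℓ} (U : Ultrafilter I) (P : I → Str) → (∀ i → S (P i)) → S (ultraprod U P)

-- A member A of HSP S⁺ is a quotient of some D ↪ ∏ᵢ Pᵢ⁺ with Pᵢ ∈ S.
-- By (A1), Aσ is a quotient of Dσ and Dσ ↪ (∏ᵢ Pᵢ⁺)σ. By (A4) the latter embeds
-- into ∏_U (∏_U Pᵢ⁺)σ, by (A2) and (A1) each factor embeds into (∏_U Pᵢ)⁺σ, and by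
-- (A3) that embeds into (Qᵁ)⁺ for an ultrapower Qᵁ of Q = ∏_U Pᵢ. Since S is closed
-- under ultraproducts, every Qᵁ lies in S, so Aσ ∈ HSP S⁺.
module Submission where

open import Defs
open import Level using (Level)
open import Relation.Unary using (Pred)
open import Data.Product using (_,_; proj₁; proj₂)
open import Relation.Binary.PropositionalEquality using (_≡_; refl; sym)

module _ {Sg : Signature} {ℓ : Level} where

  ↣-refl : (A : Algebra Sg ℓ) → A ↣ A
  ↣-refl A = record { map = λ x → x ; cong = λ e → e ; hom = λ _ _ → Algebra.refl A }
           , λ e → e

  ↣-reflexive : {A B : Algebra Sg ℓ} → A ≡ B → A ↣ B
  ↣-reflexive {A} refl = ↣-refl A

  ↣-trans : {A B C : Algebra Sg ℓ} → A ↣ B → B ↣ C → A ↣ C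
  ↣-trans {C = C} (h , h-inj) (g , g-inj) =
    record { map  = λ x → Hom.map g (Hom.map h x)
           ; cong = λ e → Hom.cong g (Hom.cong h e)
           ; hom  = λ f xs → Algebra.trans C (Hom.cong g (Hom.hom h f xs)) (Hom.hom g f _) }
    , λ e → h-inj (g-inj e)

  ∏-map-↣ : {I : Set ℓ} {A B : I → Algebra Sg ℓ} → (∀ i → A i ↣ B i) → ∏ I A ↣ ∏ I B
  ∏-map-↣ hs =
    record { map  = λ x i → Hom.map (proj₁ (hs i)) (x i)
           ; cong = λ e i → Hom.cong (proj₁ (hs i)) (e i)
           ; hom  = λ f xs i → Hom.hom (proj₁ (hs i)) f (λ k → xs k i) }
    , λ e i → proj₂ (hs i) (e i)

module CanonicityFrameworkProperties {Sg : Signature} {ℓ s k : Level}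
                                     (F : CanonicityFramework Sg ℓ s k) where
  open CanonicityFramework F
  open IsVariety 𝒞-variety

  _ᵁ : Str → Str
  P ᵁ = ultraprod (proj₁ (proj₂ (A3 P))) (λ _ → P)

  σ-⁺-↣-ᵁ⁺ : ∀ P → ((P ⁺) ^σ) ↣ ((P ᵁ) ⁺)
  σ-⁺-↣-ᵁ⁺ P = proj₂ (proj₂ (A3 P))

  UltraClosed⇒ᵁ-closed : ∀ {p} {S : Pred Str p} → UltraClosed S → ∀ {P} → S P → S (P ᵁ)
  UltraClosed⇒ᵁ-closed closed {P} SP = closed (proj₁ (proj₂ (A3 P))) (λ _ → P) (λ _ → SP)

  ∏-⁺-in-𝒞 : ∀ {I : Set ℓ} (P : I → Str) → 𝒞 (∏ I (λ i → P i ⁺))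
  ∏-⁺-in-𝒞 P = P-closed _ (λ i → ⁺-in-𝒞 (P i))

  ∏[]-⁺-in-𝒞 : ∀ {I : Set ℓ} (U : Ultrafilter I) (P : I → Str) → 𝒞 (∏[ U ] (λ i → P i ⁺))
  ∏[]-⁺-in-𝒞 U P = S-closed (⁺-in-𝒞 (ultraprod U P)) (A2 U P)

  σ-∏[]-⁺-↣ : ∀ {I : Set ℓ} (U : Ultrafilter I) (P : I → Str) →
              (∏[ U ] (λ i → P i ⁺) ^σ) ↣ ((ultraprod U P ᵁ) ⁺)
  σ-∏[]-⁺-↣ U P = ↣-trans (A1-inj (∏[]-⁺-in-𝒞 U P) (⁺-in-𝒞 (ultraprod U P)) (A2 U P))
                          (σ-⁺-↣-ᵁ⁺ (ultraprod U P))

  σ-∏-⁺-↣ : ∀ {I : Set ℓ} (P : I → Str) →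
            (∏ I (λ i → P i ⁺) ^σ) ↣ ∏ (Ultrafilter I) (λ U → (ultraprod U P ᵁ) ⁺)
  σ-∏-⁺-↣ P = ↣-trans (A4 P) (∏-map-↣ (λ U → σ-∏[]-⁺-↣ U P))

theorem7p1 : ∀ {Sg : Signature} {ℓ s k p : Level} (F : CanonicityFramework Sg ℓ s k) →
    let open CanonicityFramework F in
    (S : Pred Str p) → UltraClosed S →
    ∀ A → HSP (S ⁺-class) A → HSP (S ⁺-class) (A ^σ)
theorem7p1 F S closed A (I , As , As∈S⁺ , D , D↣∏As , D↠A) =
  Ultrafilter I , (λ U → (ultraprod U P ᵁ) ⁺) ,
  (λ U → ultraprod U P ᵁ , UltraClosed⇒ᵁ-closed {S = S} closed (closed U P P∈S) , refl) ,
  D ^σ , ↣-trans (A1-inj D∈𝒞 (∏-⁺-in-𝒞 P) D↣∏P⁺) (σ-∏-⁺-↣ P) ,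
  A1-surj D∈𝒞 (H-closed D∈𝒞 D↠A) D↠A
  where
  open CanonicityFramework F
  open IsVariety 𝒞-variety
  open CanonicityFrameworkProperties F

  P : I → Str
  P i = proj₁ (As∈S⁺ i)

  P∈S : ∀ i → S (P i)
  P∈S i = proj₁ (proj₂ (As∈S⁺ i))

  D↣∏P⁺ : D ↣ ∏ I (λ i → P i ⁺)
  D↣∏P⁺ = ↣-trans D↣∏As (∏-map-↣ (λ i → ↣-reflexive (sym (proj₂ (proj₂ (As∈S⁺ i))))))

  D∈𝒞 : 𝒞 D
  D∈𝒞 = S-closed (∏-⁺-in-𝒞 P) D↣∏P⁺
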